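{- Let $n\ge 2$ and let $c$ be a prime power with $c\equiv1\pmod{2n}$ such that $c+n=\binom{k}{2}$ for some integer $k\ge 2n$. Let $d=1+(c-1)/n$. Then $2n+2\le k\le n+d$. -}

module Defs where

open import Data.Nat using (ℕ; suc; _*_; _^_; _<_)
open import Data.Nat.Primality using (Prime)
open import Data.Product using (Σ-syntax; _×_)
open import Relation.Binary.PropositionalEquality using (_≡_)

IsPrimePower : ℕ → Set
IsPrimePower c = Σ[ p ∈ ℕ ] Σ[ e ∈ ℕ ] (Prime p × 0 < e × c ≡ p ^ e)

-- With c = 1 + 2nq, doubling c + n = C(k,2) gives k(k − 1) = 2n(2q + 1) + 2, which
-- leaves remainder 2 modulo 2n ≥ 4. So k(k − 1) is not a multiple of 2n, excluding
-- k = 2n and k = 2n + 1. Moreover d = 1 + 2q, and (n + d + 1)(n + d) already exceeds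
-- 2n(2q + 1) + 2, so k ≤ n + d.
module Submission where

open import Defs
open import Data.Nat using (ℕ; NonZero; _+_; _*_; _∸_; _≤_; _<_; _/_; suc; zero; pred; s≤s; z≤n)
open import Data.Nat.Properties
open import Data.Nat.Divisibility using (_∣_; divides; ∣m+n∣m⇒∣n; ∣⇒≤; n∣m*n; m∣m*n)
open import Data.Nat.Combinatorics using (_C_; nC1≡n; nCk+nC[k+1]≡[n+1]C[k+1])
open import Data.Nat.DivMod using (m*n/n≡m)
open import Data.Nat.Primality using (prime⇒nonZero)
open import Data.Nat.Solver using (module +-*-Solver)
open +-*-Solver
open import Data.Product using (_×_; _,_)
open import Data.Sum using (inj₁; inj₂)
open import Relation.Nullary using (¬_; contradiction)
open import Relation.Binary.PropositionalEquality

2*[nC2]≡n*pred[n] : ∀ n → 2 * (n C 2) ≡ n * pred n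
2*[nC2]≡n*pred[n] zero = refl
2*[nC2]≡n*pred[n] (suc zero) = refl
2*[nC2]≡n*pred[n] (suc (suc n)) = begin
  2 * (suc (suc n) C 2)          ≡⟨ cong (2 *_) (nCk+nC[k+1]≡[n+1]C[k+1] (suc n) 1) ⟨
  2 * (suc n C 1 + suc n C 2)    ≡⟨ cong (λ x → 2 * (x + suc n C 2)) (nC1≡n (suc n)) ⟩
  2 * (suc n + suc n C 2)        ≡⟨ *-distribˡ-+ 2 (suc n) (suc n C 2) ⟩
  2 * suc n + 2 * (suc n C 2)    ≡⟨ cong (2 * suc n +_) (2*[nC2]≡n*pred[n] (suc n)) ⟩
  2 * suc n + suc n * n          ≡⟨ solve 1 (λ n → con 2 :* (con 1 :+ n) :+ (con 1 :+ n) :* n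
                                                := (con 2 :+ n) :* (con 1 :+ n)) refl n ⟩
  suc (suc n) * suc n            ∎
  where open ≡-Reasoning

primePower⇒>0 : ∀ {c} → IsPrimePower c → 0 < c
primePower⇒>0 (p , e , p-prime , _ , refl) = m^n>0 p {{prime⇒nonZero p-prime}} e

0<r<d⇒d∤d*t+r : ∀ {d r} t → 0 < r → r < d → ¬ d ∣ d * t + r
0<r<d⇒d∤d*t+r {d} {suc r} t _ r<d d∣dt+r =
  <⇒≱ r<d (∣⇒≤ (∣m+n∣m⇒∣n d∣dt+r (m∣m*n t)))

≤∧∤n*pred[n]⇒2+≤ : ∀ {d k} → d ≤ k → ¬ d ∣ k * pred k → d + 2 ≤ k
≤∧∤n*pred[n]⇒2+≤ {d} {k} d≤k d∤ with m≤n⇒m<n∨m≡n d≤k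
... | inj₂ refl = contradiction (m∣m*n (pred d)) d∤
... | inj₁ d<k with m≤n⇒m<n∨m≡n d<k
...   | inj₂ refl = contradiction (n∣m*n (suc d)) d∤
...   | inj₁ d+1<k = subst (_≤ k) (+-comm 2 d) d+1<k

n*pred[n]<[1+a]*a⇒n≤a : ∀ {n a} → n * pred n < suc a * a → n ≤ a
n*pred[n]<[1+a]*a⇒n≤a lt =
  ≮⇒≥ (λ a<n → <⇒≱ lt (*-mono-≤ a<n (pred-mono-≤ a<n)))

2n[2q+1]+2<[n+2q+2][n+2q+1] : ∀ n q → .{{_ : NonZero n}} →
  2 * n * (2 * q + 1) + 2 < suc (n + (1 + q * 2)) * (n + (1 + q * 2))
2n[2q+1]+2<[n+2q+2][n+2q+1] (suc m) q = begin-strict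
  2 * n * (2 * q + 1) + 2                        <⟨ m<m+n _ (s≤s z≤n) ⟩
  2 * n * (2 * q + 1) + 2 + suc (n * n + m + 4 * (q * q) + 6 * q)
    ≡⟨ solve 2 (λ m q →
         con 2 :* (con 1 :+ m) :* (con 2 :* q :+ con 1) :+ con 2
           :+ (con 1 :+ ((con 1 :+ m) :* (con 1 :+ m) :+ m :+ con 4 :* (q :* q) :+ con 6 :* q))
         := (con 1 :+ ((con 1 :+ m) :+ (con 1 :+ q :* con 2))) :* ((con 1 :+ m) :+ (con 1 :+ q :* con 2)))
       refl m q ⟩
  suc (n + (1 + q * 2)) * (n + (1 + q * 2))      ∎
  where
  open ≤-Reasoning
  n = suc m

lemma5p3 : (n c k : ℕ) → .{{_ : NonZero n}} → 2 ≤ n → IsPrimePower c →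
    2 * n ∣ c ∸ 1 → 2 * n ≤ k → c + n ≡ k C 2 →
    (2 * n + 2 ≤ k) × (k ≤ n + (1 + (c ∸ 1) / n))
lemma5p3 n c k 2≤n c-pp (divides q c∸1≡q*2n) 2n≤k c+n≡kC2 =
  ≤∧∤n*pred[n]⇒2+≤ 2n≤k 2n∤k[k-1] , n*pred[n]<[1+a]*a⇒n≤a k[k-1]<[n+d+1][n+d]
  where
  open ≡-Reasoning
  c≡1+q*2n : c ≡ 1 + q * (2 * n)
  c≡1+q*2n = begin
    c           ≡⟨ m∸n+n≡m (primePower⇒>0 c-pp) ⟨
    c ∸ 1 + 1   ≡⟨ +-comm (c ∸ 1) 1 ⟩
    1 + (c ∸ 1) ≡⟨ cong (1 +_) c∸1≡q*2n ⟩
    1 + q * (2 * n) ∎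
  k[k-1]≡ : k * pred k ≡ 2 * n * (2 * q + 1) + 2
  k[k-1]≡ = begin
    k * pred k             ≡⟨ 2*[nC2]≡n*pred[n] k ⟨
    2 * (k C 2)            ≡⟨ cong (2 *_) c+n≡kC2 ⟨
    2 * (c + n)            ≡⟨ cong (λ x → 2 * (x + n)) c≡1+q*2n ⟩
    2 * (1 + q * (2 * n) + n)
      ≡⟨ solve 2 (λ n q → con 2 :* (con 1 :+ q :* (con 2 :* n) :+ n)
                          := con 2 :* n :* (con 2 :* q :+ con 1) :+ con 2) refl n q ⟩
    2 * n * (2 * q + 1) + 2 ∎
  2n∤k[k-1] : ¬ 2 * n ∣ k * pred k
  2n∤k[k-1] = subst (λ x → ¬ 2 * n ∣ x) (sym k[k-1]≡) (0<r<d⇒d∤d*t+r (2 * q + 1) (s≤s z≤n) (*-monoʳ-< 2 2≤n))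
  [c-1]/n≡2q : (c ∸ 1) / n ≡ q * 2
  [c-1]/n≡2q = begin
    (c ∸ 1) / n     ≡⟨ cong (_/ n) c∸1≡q*2n ⟩
    q * (2 * n) / n ≡⟨ cong (_/ n) (*-assoc q 2 n) ⟨
    q * 2 * n / n   ≡⟨ m*n/n≡m (q * 2) n ⟩
    q * 2           ∎
  k[k-1]<[n+d+1][n+d] : k * pred k < suc (n + (1 + (c ∸ 1) / n)) * (n + (1 + (c ∸ 1) / n))
  k[k-1]<[n+d+1][n+d] rewrite k[k-1]≡ | [c-1]/n≡2q = 2n[2q+1]+2<[n+2q+2][n+2q+1] n q
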